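{- Let $\mathbf{A}$ and $\mathbf{B}$ be S[I]RLs (both SRLs or both SIRLs), and let $F$ be a deductive filter of $\mathbf{A}$. (i) If $h:\mathbf{A}\to\mathbf{B}$ is a homomorphism, then $h|_{A^- }$ is a homomorphism from $\mathbf{A}^-$ to $\mathbf{B}^-$; if moreover $h$ is surjective, then so is $h|_{A^- }$ (onto $B^-$). (ii) $A^-\cap F$ is a filter of $\mathbf{A}^-$, and $(\mathbf{A}/F)^-\cong\mathbf{A}^-/(A^-\cap F)$, where the isomorphism and its inverse are given by $a/F\mapsto (a\wedge e)/(A^-\cap F)$ and $a/(A^-\cap F)\mapsto a/F$.
   Context: An SRL is an algebra $\mathbf{A}=\langle A;\wedge,\vee,\cdot,\to,e\rangle$ such that $\langle A;\wedge,\vee\rangle$ is a lattice, $\langle A;\cdot,e\rangle$ is a commutative monoid, $x\cdot y\leqslant z\iff x\leqslant y\to z$, and $x\leqslant e$ implies $x\cdot x=x$. An SIRL is an SRL expanded by a unary $\neg$ with $\neg\neg x=x$ and $x\to\neg y=y\to\neg x$. The negative cone of $\mathbf{A}$ is the Brouwerian algebra $\mathbf{A}^-=\langle A^-;\wedge,\vee,\to^-,e\rangle$ with $A^-=\{a\in A:a\leqslant e\}$, restricted lattice operations, and $a\to^- b=(a\to b)\wedge e$. A deductive filter of an S[I]RL $\mathbf{A}$ is a nonempty upward closed subset closed under $\wedge$ and containing $e$; a filter of the Brouwerian algebra $\mathbf{A}^-$ is a nonempty upward closed subset of $A^-$ closed under $\wedge$. Write $x\leftrightarrow y=(x\to y)\wedge(y\to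 x)$. For a deductive filter $F$ of $\mathbf{A}$, $\mathbf{A}/F$ denotes the quotient of $\mathbf{A}$ by the congruence $\{\langle a,b\rangle\in A^2: a\leftrightarrow b\in F\}$, and $a/F$ the class of $a$; similarly $\mathbf{A}^-/G$ for a filter $G$ of $\mathbf{A}^-$ is the quotient by $\{\langle a,b\rangle\in (A^-)^2:(a\to^-b)\wedge(b\to^-a)\in G\}$. -}

module Defs where

open import Level using (Level; _⊔_) renaming (suc to lsuc)
open import Relation.Binary.Core using (Rel)
open import Relation.Unary using (Pred)
open import Data.Product using (Σ; ∃; _×_; _,_)
open import Algebra.Core using (Op₁; Op₂)
open import Algebra.Lattice.Structures using (IsLattice)
open import Algebra.Structures using (IsCommutativeMonoid)
open import Algebra.Definitions using (Congruent₁; Congruent₂)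

record SRL (c ℓ : Level) : Set (lsuc (c ⊔ ℓ)) where
  infix  4 _≈_ _≤_
  infixr 6 _∧_
  infixr 5 _∨_
  infixl 7 _·_
  infixr 4 _⇒_
  field
    Carrier : Set c
    _≈_     : Rel Carrier ℓ
    _∧_ _∨_ _·_ _⇒_ : Op₂ Carrier
    e       : Carrier
    isLattice           : IsLattice _≈_ _∨_ _∧_
    isCommutativeMonoid : IsCommutativeMonoid _≈_ _·_ e
    ⇒-cong              : Congruent₂ _≈_ _⇒_

  _≤_ : Rel Carrier ℓ
  x ≤ y = (x ∧ y) ≈ x

  field
    residuation : ∀ x y z → ((x · y ≤ z) → (x ≤ (y ⇒ z))) × ((x ≤ (y ⇒ z)) → (x · y ≤ z))
    idempotent-below-e : ∀ x → x ≤ e → x · x ≈ x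

  _⇔_ : Op₂ Carrier
  x ⇔ y = (x ⇒ y) ∧ (y ⇒ x)

record SIRL (c ℓ : Level) : Set (lsuc (c ⊔ ℓ)) where
  field
    srl : SRL c ℓ
  open SRL srl
  field
    ¬_     : Op₁ Carrier
    ¬-cong : Congruent₁ _≈_ ¬_
    ¬¬     : ∀ x → ¬ (¬ x) ≈ x
    ⇒¬     : ∀ x y → (x ⇒ (¬ y)) ≈ (y ⇒ (¬ x))

record IsSRLHom {a ℓa b ℓb} (A : SRL a ℓa) (B : SRL b ℓb)
                (h : SRL.Carrier A → SRL.Carrier B) : Set (a ⊔ ℓa ⊔ ℓb) where
  private
    module A = SRL A
    module B = SRL B
  field
    cong   : ∀ {x y} → x A.≈ y → h x B.≈ h y
    hom-∧  : ∀ x y → h (x A.∧ y) B.≈ (h x B.∧ h y)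
    hom-∨  : ∀ x y → h (x A.∨ y) B.≈ (h x B.∨ h y)
    hom-·  : ∀ x y → h (x A.· y) B.≈ (h x B.· h y)
    hom-⇒  : ∀ x y → h (x A.⇒ y) B.≈ (h x B.⇒ h y)
    hom-e  : h A.e B.≈ B.e

record IsSIRLHom {a ℓa b ℓb} (A : SIRL a ℓa) (B : SIRL b ℓb)
                 (h : SRL.Carrier (SIRL.srl A) → SRL.Carrier (SIRL.srl B))
                 : Set (a ⊔ ℓa ⊔ ℓb) where
  field
    isSRLHom : IsSRLHom (SIRL.srl A) (SIRL.srl B) h
    hom-¬    : ∀ x → SRL._≈_ (SIRL.srl B) (h (SIRL.¬_ A x)) (SIRL.¬_ B (h x))

Surjective : ∀ {a b ℓ} {X : Set a} {Y : Set b} → Rel Y ℓ → (X → Y) → Set (a ⊔ b ⊔ ℓ)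
Surjective {X = X} _≈_ h = ∀ y → ∃ λ (x : X) → h x ≈ y

record IsDeductiveFilter {a ℓa ℓf} (A : SRL a ℓa)
                         (F : Pred (SRL.Carrier A) ℓf) : Set (a ⊔ ℓa ⊔ ℓf) where
  open SRL A
  field
    nonempty    : ∃ λ x → F x
    upward      : ∀ {x y} → F x → x ≤ y → F y
    ∧-closed    : ∀ {x y} → F x → F y → F (x ∧ y)
    contains-e  : F e

-- Brouwerian-algebra signatures presented as a subset of an ambient
-- carrier U (elements are those u with Dom u), an equivalence _≈_
-- (the algebra's equality) and operations given on U.

record BrSig (u d r : Level) : Set (lsuc (u ⊔ d ⊔ r)) where
  field
    U    : Set u
    Dom  : Pred U d
    _≈_  : Rel U r
    _∧_ _∨_ _⇒_ : Op₂ U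
    e    : U

record IsBrHom {u₁ d₁ r₁ u₂ d₂ r₂} (P : BrSig u₁ d₁ r₁) (Q : BrSig u₂ d₂ r₂)
               (f : BrSig.U P → BrSig.U Q) : Set (u₁ ⊔ d₁ ⊔ r₁ ⊔ d₂ ⊔ r₂) where
  private
    module P = BrSig P
    module Q = BrSig Q
  field
    maps-into : ∀ {x} → P.Dom x → Q.Dom (f x)
    cong      : ∀ {x y} → P.Dom x → P.Dom y → x P.≈ y → f x Q.≈ f y
    hom-∧     : ∀ {x y} → P.Dom x → P.Dom y → f (x P.∧ y) Q.≈ (f x Q.∧ f y)
    hom-∨     : ∀ {x y} → P.Dom x → P.Dom y → f (x P.∨ y) Q.≈ (f x Q.∨ f y)
    hom-⇒     : ∀ {x y} → P.Dom x → P.Dom y → f (x P.⇒ y) Q.≈ (f x Q.⇒ f y)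
    hom-e     : f P.e Q.≈ Q.e

SurjectiveOnto : ∀ {u₁ d₁ r₁ u₂ d₂ r₂} (P : BrSig u₁ d₁ r₁) (Q : BrSig u₂ d₂ r₂)
                 → (BrSig.U P → BrSig.U Q) → Set (u₁ ⊔ d₁ ⊔ u₂ ⊔ d₂ ⊔ r₂)
SurjectiveOnto P Q f =
  ∀ y → BrSig.Dom Q y → ∃ λ x → BrSig.Dom P x × BrSig._≈_ Q (f x) y

record IsBrIso {u₁ d₁ r₁ u₂ d₂ r₂} (P : BrSig u₁ d₁ r₁) (Q : BrSig u₂ d₂ r₂)
               (f : BrSig.U P → BrSig.U Q) (g : BrSig.U Q → BrSig.U P)
               : Set (u₁ ⊔ d₁ ⊔ r₁ ⊔ u₂ ⊔ d₂ ⊔ r₂) where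
  field
    f-hom   : IsBrHom P Q f
    g-hom   : IsBrHom Q P g
    g∘f≈id  : ∀ {x} → BrSig.Dom P x → BrSig._≈_ P (g (f x)) x
    f∘g≈id  : ∀ {y} → BrSig.Dom Q y → BrSig._≈_ Q (f (g y)) y

module _ {a ℓa} (A : SRL a ℓa) where
  open SRL A

  _⇒⁻_ : Op₂ Carrier
  x ⇒⁻ y = (x ⇒ y) ∧ e

  NegCone : BrSig a ℓa ℓa
  NegCone = record
    { U = Carrier ; Dom = λ x → x ≤ e ; _≈_ = _≈_
    ; _∧_ = _∧_ ; _∨_ = _∨_ ; _⇒_ = _⇒⁻_ ; e = e }

  record IsNegConeFilter {ℓg} (G : Pred Carrier ℓg) : Set (a ⊔ ℓa ⊔ ℓg) where
    field
      ⊆A⁻      : ∀ {x} → G x → x ≤ e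
      nonempty : ∃ λ x → G x
      upward   : ∀ {x y} → G x → x ≤ y → y ≤ e → G y
      ∧-closed : ∀ {x y} → G x → G y → G (x ∧ y)

  _∩⁻_ : ∀ {ℓf} → Pred Carrier ℓf → Pred Carrier (ℓa ⊔ ℓf)
  _∩⁻_ F x = x ≤ e × F x

  _≈[_]_ : ∀ {ℓf} → Carrier → Pred Carrier ℓf → Carrier → Set ℓf
  x ≈[ F ] y = F (x ⇔ y)

  -- (A/F)⁻ : the negative cone of the quotient A/F, with elements
  -- represented by elements of A (a/F ≤ e/F) and equality of classes
  QuotNegCone : ∀ {ℓf} → Pred Carrier ℓf → BrSig a ℓf ℓf
  QuotNegCone F = record
    { U = Carrier ; Dom = λ x → (x ∧ e) ≈[ F ] x ; _≈_ = λ x y → x ≈[ F ] y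
    ; _∧_ = _∧_ ; _∨_ = _∨_ ; _⇒_ = _⇒⁻_ ; e = e }

  NegConeQuot : ∀ {ℓg} → Pred Carrier ℓg → BrSig a ℓa ℓg
  NegConeQuot G = record
    { U = Carrier ; Dom = λ x → x ≤ e
    ; _≈_ = λ x y → G ((x ⇒⁻ y) ∧ (y ⇒⁻ x))
    ; _∧_ = _∧_ ; _∨_ = _∨_ ; _⇒_ = _⇒⁻_ ; e = e }

Part-ii : ∀ {a ℓa ℓf} (A : SRL a ℓa) (F : Pred (SRL.Carrier A) ℓf) → Set (a ⊔ ℓa ⊔ ℓf)
Part-ii A F =
  IsNegConeFilter A (_∩⁻_ A F)
  × IsBrIso (QuotNegCone A F) (NegConeQuot A (_∩⁻_ A F))
            (λ x → SRL._∧_ A x (SRL.e A)) (λ x → x)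

Part-i : ∀ {a ℓa b ℓb} (A : SRL a ℓa) (B : SRL b ℓb)
         → (SRL.Carrier A → SRL.Carrier B) → Set (a ⊔ ℓa ⊔ b ⊔ ℓb)
Part-i A B h =
  IsBrHom (NegCone A) (NegCone B) h
  × (Surjective (SRL._≈_ B) h → SurjectiveOnto (NegCone A) (NegCone B) h)

module Submission where

-- Both congruences are
--    handled by one criterion: a ∼ b holds in A⁻/(A⁻∩F) as soon as some
--    u ∈ F lies below both a →⁻ b and b →⁻ a.  The homomorphism laws of
--    a ↦ a∧e are established by exhibiting such witnesses, built from the
--    F-elements (x∧e) ↔ x that say x/F lies in (A/F)⁻; those of a ↦ a hold
--    since the operations of A/F and of A⁻ agree on A⁻.
--  * `RestrictedHom h` proves part (i): h commutes with _∧ e, hence with →⁻.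
-- The theorem treats SIRLs through their SRL reducts, since neither part
-- mentions the negation.

open import Defs hiding (_⇒⁻_)
import Defs
open import Level using (_⊔_)
open import Relation.Unary using (Pred)
open import Data.Product using (_×_; _,_; proj₁; proj₂)
open import Algebra.Lattice.Bundles using (Lattice)
open import Algebra.Lattice.Structures using (IsLattice)
open import Algebra.Structures using (IsCommutativeMonoid)
import Algebra.Lattice.Properties.Lattice as LatticeProperties
import Relation.Binary.Lattice as Order
import Relation.Binary.Lattice.Properties.MeetSemilattice as MeetProperties
import Relation.Binary.Lattice.Properties.JoinSemilattice as JoinProperties
import Relation.Binary.Reasoning.PartialOrder as PartialOrderReasoning

module SRLFacts {c ℓ} (A : SRL c ℓ) where
  open SRL A public
  open IsLattice isLattice public using (refl; sym; trans; ∧-cong)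
  open IsCommutativeMonoid isCommutativeMonoid public using (assoc; comm; identityˡ; identityʳ; ∙-congʳ)

  infixr 4.5 _⇒⁻_
  _⇒⁻_ : Carrier → Carrier → Carrier
  _⇒⁻_ = Defs._⇒⁻_ A

  -- The library orders an algebraic lattice by x ≈ x ∧ y; the SRL order
  -- x ∧ y ≈ x is the same relation up to symmetry of ≈, so it also makes
  -- A an order-theoretic lattice.
  isOrderLattice : Order.IsLattice _≈_ _≤_ _∨_ _∧_
  isOrderLattice = record
    { isPartialOrder = record
      { isPreorder = record
        { isEquivalence = isEquivalence
        ; reflexive     = λ x≈y → sym (L.reflexive x≈y)
        ; trans         = λ x≤y y≤z → sym (L.trans (sym x≤y) (sym y≤z))
        }
      ; antisym = λ x≤y y≤x → L.antisym (sym x≤y) (sym y≤x)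
      }
    ; supremum = λ x y → sym (L.x≤x∨y x y) , sym (L.y≤x∨y x y)
                       , λ z x≤z y≤z → sym (L.∨-least (sym x≤z) (sym y≤z))
    ; infimum  = λ x y → sym (L.x∧y≤x x y) , sym (L.x∧y≤y x y)
                       , λ z z≤x z≤y → sym (L.∧-greatest (sym z≤x) (sym z≤y))
    }
    where
    open IsLattice isLattice using (isEquivalence)
    lattice : Lattice c ℓ
    lattice = record { isLattice = isLattice }
    module L = Order.IsLattice (LatticeProperties.∨-∧-isOrderTheoreticLattice lattice)

  orderLattice : Order.Lattice c ℓ ℓ
  orderLattice = record { isLattice = isOrderLattice }

  open Order.Lattice orderLattice public
    using (x∧y≤x; x∧y≤y; ∧-greatest; x≤x∨y; y≤x∨y; ∨-least; antisym; poset)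
    renaming (refl to ≤-refl; trans to ≤-trans; reflexive to ≤-reflexive)
  open MeetProperties (Order.Lattice.meetSemilattice orderLattice) public using (∧-monotonic)
  open JoinProperties (Order.Lattice.joinSemilattice orderLattice) public using (∨-monotonic)
  module ≤-Reasoning = PartialOrderReasoning poset

  residuate : ∀ {x y z} → x · y ≤ z → x ≤ (y ⇒ z)
  residuate {x} {y} {z} = proj₁ (residuation x y z)

  unresiduate : ∀ {x y z} → x ≤ (y ⇒ z) → x · y ≤ z
  unresiduate {x} {y} {z} = proj₂ (residuation x y z)

  modus-ponens : ∀ {y z} → (y ⇒ z) · y ≤ z
  modus-ponens = unresiduate ≤-refl

  -- multiplication is monotone, since x ↦ x · c is a left adjoint
  ·-monoˡ : ∀ {a b c} → a ≤ b → a · c ≤ b · c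
  ·-monoˡ a≤b = unresiduate (≤-trans a≤b (residuate ≤-refl))

  ·-monoʳ : ∀ {a b c} → a ≤ b → c · a ≤ c · b
  ·-monoʳ {a} {b} {c} a≤b = begin
    c · a  ≈⟨ comm c a ⟩
    a · c  ≤⟨ ·-monoˡ a≤b ⟩
    b · c  ≈⟨ comm b c ⟩
    c · b  ∎
    where open ≤-Reasoning

  -- multiplication by u is a left adjoint, so it preserves joins
  ·-distrib-∨ : ∀ {u x y} → u · (x ∨ y) ≤ (u · x) ∨ (u · y)
  ·-distrib-∨ {u} {x} {y} = begin
    u · (x ∨ y)        ≈⟨ comm u (x ∨ y) ⟩
    (x ∨ y) · u        ≤⟨ unresiduate (∨-least (residuate x·u≤) (residuate y·u≤)) ⟩
    (u · x) ∨ (u · y)  ∎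
    where
    open ≤-Reasoning
    x·u≤ : x · u ≤ (u · x) ∨ (u · y)
    x·u≤ = ≤-trans (≤-reflexive (comm x u)) (x≤x∨y _ _)
    y·u≤ : y · u ≤ (u · x) ∨ (u · y)
    y·u≤ = ≤-trans (≤-reflexive (comm y u)) (y≤x∨y _ _)

  ·-decreasingʳ : ∀ {u a} → u ≤ e → u · a ≤ a
  ·-decreasingʳ {u} {a} u≤e = ≤-trans (·-monoˡ u≤e) (≤-reflexive (identityˡ a))

  ·-decreasingˡ : ∀ {u a} → a ≤ e → u · a ≤ u
  ·-decreasingˡ {u} {a} a≤e = ≤-trans (·-monoʳ a≤e) (≤-reflexive (identityʳ u))

  ≤⇒⁻ : ∀ {u a b} → u ≤ e → u · a ≤ b → u ≤ a ⇒⁻ b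
  ≤⇒⁻ u≤e u·a≤b = ∧-greatest (residuate u·a≤b) u≤e

  e≤⇒ : ∀ {a b} → a ≤ b → e ≤ (a ⇒ b)
  e≤⇒ {a} a≤b = residuate (≤-trans (≤-reflexive (identityˡ a)) a≤b)

  e≤⇒⁻ : ∀ {a b} → a ≤ b → e ≤ a ⇒⁻ b
  e≤⇒⁻ a≤b = ∧-greatest (e≤⇒ a≤b) ≤-refl

  e≤⇔ : ∀ {a b} → a ≈ b → e ≤ a ⇔ b
  e≤⇔ a≈b = ∧-greatest (e≤⇒ (≤-reflexive a≈b)) (e≤⇒ (≤-reflexive (sym a≈b)))

  retract : ∀ {u x} → u ≤ (x ∧ e) ⇔ x → u · x ≤ x ∧ e
  retract u≤ = unresiduate (≤-trans u≤ (x∧y≤y _ _))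

  -- Cutting both arguments down to the negative cone can only enlarge →⁻:
  -- this is what makes x ↦ x ∧ e compatible with residuation.
  ⇒⁻-≤-cut : ∀ {x y} → x ⇒⁻ y ≤ (x ∧ e) ⇒⁻ (y ∧ e)
  ⇒⁻-≤-cut {x} {y} = ≤⇒⁻ (x∧y≤y _ _) (∧-greatest into-y into-e)
    where
    into-y : (x ⇒⁻ y) · (x ∧ e) ≤ y
    into-y = ≤-trans (·-monoʳ (x∧y≤x _ _)) (≤-trans (·-monoˡ (x∧y≤x _ _)) modus-ponens)
    into-e : (x ⇒⁻ y) · (x ∧ e) ≤ e
    into-e = ≤-trans (·-decreasingˡ (x∧y≤y _ _)) (x∧y≤y _ _)

  cut-∧ : ∀ x y → (x ∧ y) ∧ e ≈ (x ∧ e) ∧ (y ∧ e)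
  cut-∧ x y = antisym
    (∧-greatest (∧-monotonic (x∧y≤x _ _) ≤-refl) (∧-monotonic (x∧y≤y _ _) ≤-refl))
    (∧-greatest (∧-monotonic (x∧y≤x _ _) (x∧y≤x _ _)) (≤-trans (x∧y≤x _ _) (x∧y≤y _ _)))

  cut-∨ : ∀ {x y} → (x ∧ e) ∨ (y ∧ e) ≤ (x ∨ y) ∧ e
  cut-∨ = ∧-greatest (∨-monotonic (x∧y≤x _ _) (x∧y≤x _ _)) (∨-least (x∧y≤y _ _) (x∧y≤y _ _))

module NegativeConeQuotient {c ℓ ℓf} (A : SRL c ℓ) (F : Pred (SRL.Carrier A) ℓf)
                            (isFilter : IsDeductiveFilter A F) where
  open SRLFacts A
  open IsDeductiveFilter isFilter

  G : Pred Carrier (ℓ ⊔ ℓf)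
  G = _∩⁻_ A F

  _≈ᶠ_ : Carrier → Carrier → Set ℓf
  a ≈ᶠ b = _≈[_]_ A a F b

  _∼_ : Carrier → Carrier → Set (ℓ ⊔ ℓf)
  a ∼ b = G ((a ⇒⁻ b) ∧ (b ⇒⁻ a))

  ∩⁻-isFilter : IsNegConeFilter A G
  ∩⁻-isFilter = record
    { ⊆A⁻      = proj₁
    ; nonempty = e , ≤-refl , contains-e
    ; upward   = λ { (_ , Fx) x≤y y≤e → y≤e , upward Fx x≤y }
    ; ∧-closed = λ { (x≤e , Fx) (_ , Fy) → ≤-trans (x∧y≤x _ _) x≤e , ∧-closed Fx Fy }
    }

  -- Criterion for a ∼ b: one element of F below both a →⁻ b and b →⁻ a
  -- (their meet then lies in F, and it is in A⁻ by definition of →⁻).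
  ∼-witness : ∀ {u a b} → F u → u ≤ a ⇒⁻ b → u ≤ b ⇒⁻ a → a ∼ b
  ∼-witness Fu u≤ab u≤ba =
    ≤-trans (x∧y≤x _ _) (x∧y≤y _ _) , upward Fu (∧-greatest u≤ab u≤ba)

  ∼-reflexive : ∀ {a b} → a ≈ b → a ∼ b
  ∼-reflexive a≈b =
    ∼-witness contains-e (e≤⇒⁻ (≤-reflexive a≈b)) (e≤⇒⁻ (≤-reflexive (sym a≈b)))

  ≈ᶠ-reflexive : ∀ {a b} → a ≈ b → a ≈ᶠ b
  ≈ᶠ-reflexive a≈b = upward contains-e (e≤⇔ a≈b)

  -- Elements of (A/F)⁻ are the x with (x ∧ e) ≈[F] x.  For such x and y,
  -- the element  ((x∧e) ↔ x) ∧ ((y∧e) ↔ y) ∧ e  of F witnesses that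
  -- cutting by e commutes with ∨ modulo G.
  cut-hom-∨ : ∀ {x y} → (x ∧ e) ≈ᶠ x → (y ∧ e) ≈ᶠ y
            → ((x ∨ y) ∧ e) ∼ ((x ∧ e) ∨ (y ∧ e))
  cut-hom-∨ {x} {y} x∈ y∈ =
    ∼-witness (∧-closed x∈ (∧-closed y∈ contains-e)) (≤⇒⁻ u≤e join-down) (≤⇒⁻ u≤e join-up)
    where
    open ≤-Reasoning
    u = ((x ∧ e) ⇔ x) ∧ ((y ∧ e) ⇔ y) ∧ e
    u≤e : u ≤ e
    u≤e = ≤-trans (x∧y≤y _ _) (x∧y≤y _ _)
    join-down : u · ((x ∨ y) ∧ e) ≤ (x ∧ e) ∨ (y ∧ e)
    join-down = begin
      u · ((x ∨ y) ∧ e)  ≤⟨ ·-monoʳ (x∧y≤x _ _) ⟩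
      u · (x ∨ y)        ≤⟨ ·-distrib-∨ ⟩
      (u · x) ∨ (u · y)  ≤⟨ ∨-monotonic (retract (x∧y≤x _ _))
                                        (retract (≤-trans (x∧y≤y _ _) (x∧y≤x _ _))) ⟩
      (x ∧ e) ∨ (y ∧ e)  ∎
    join-up : u · ((x ∧ e) ∨ (y ∧ e)) ≤ (x ∨ y) ∧ e
    join-up = ≤-trans (·-decreasingʳ u≤e) cut-∨

  -- likewise ((x∧e) ↔ x) ∧ e witnesses that cutting commutes with →⁻
  cut-hom-⇒⁻ : ∀ {x y} → (x ∧ e) ≈ᶠ x
             → ((x ⇒⁻ y) ∧ e) ∼ ((x ∧ e) ⇒⁻ (y ∧ e))
  cut-hom-⇒⁻ {x} {y} x∈ =
    ∼-witness (∧-closed x∈ contains-e)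
              (≤-trans u≤e (e≤⇒⁻ (≤-trans (x∧y≤x _ _) ⇒⁻-≤-cut)))
              (≤⇒⁻ u≤e (∧-greatest (∧-greatest (residuate u·b·x≤y) u·b≤e) u·b≤e))
    where
    open ≤-Reasoning
    u = ((x ∧ e) ⇔ x) ∧ e
    b = (x ∧ e) ⇒⁻ (y ∧ e)
    u≤e : u ≤ e
    u≤e = x∧y≤y _ _
    u·b≤e : u · b ≤ e
    u·b≤e = ≤-trans (·-decreasingʳ u≤e) (x∧y≤y _ _)
    u·b·x≤y : (u · b) · x ≤ y
    u·b·x≤y = begin
      (u · b) · x  ≈⟨ ∙-congʳ (comm u b) ⟩
      (b · u) · x  ≈⟨ assoc b u x ⟩
      b · (u · x)  ≤⟨ ·-monoʳ (retract (x∧y≤x _ _)) ⟩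
      b · (x ∧ e)  ≤⟨ ·-monoˡ (x∧y≤x _ _) ⟩
      ((x ∧ e) ⇒ (y ∧ e)) · (x ∧ e)  ≤⟨ modus-ponens ⟩
      y ∧ e        ≤⟨ x∧y≤x _ _ ⟩
      y            ∎

  cut-isHom : IsBrHom (QuotNegCone A F) (NegConeQuot A G) (λ x → x ∧ e)
  cut-isHom = record
    { maps-into = λ _ → x∧y≤y _ _
    ; cong      = λ _ _ x≈y → ∼-witness (∧-closed x≈y contains-e)
                    (≤-trans (∧-monotonic (x∧y≤x _ _) ≤-refl) ⇒⁻-≤-cut)
                    (≤-trans (∧-monotonic (x∧y≤y _ _) ≤-refl) ⇒⁻-≤-cut)
    ; hom-∧     = λ _ _ → ∼-reflexive (cut-∧ _ _)
    ; hom-∨     = cut-hom-∨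
    ; hom-⇒     = λ x∈ _ → cut-hom-⇒⁻ x∈
    ; hom-e     = ∼-reflexive ≤-refl    -- e ∧ e ≈ e is e ≤ e
    }

  -- On A⁻ the operations of A/F are those of A⁻, so the identity is a
  -- homomorphism; it respects the equalities because G ⊆ F and
  -- a →⁻ b ≤ a → b.
  inclusion-isHom : IsBrHom (NegConeQuot A G) (QuotNegCone A F) (λ x → x)
  inclusion-isHom = record
    { maps-into = ≈ᶠ-reflexive
    ; cong      = λ _ _ a∼b → upward (proj₂ a∼b) (∧-monotonic (x∧y≤x _ _) (x∧y≤x _ _))
    ; hom-∧     = λ _ _ → ≈ᶠ-reflexive refl
    ; hom-∨     = λ _ _ → ≈ᶠ-reflexive refl
    ; hom-⇒     = λ _ _ → ≈ᶠ-reflexive refl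
    ; hom-e     = ≈ᶠ-reflexive refl
    }

  part-ii : Part-ii A F
  part-ii = ∩⁻-isFilter , record
    { f-hom  = cut-isHom
    ; g-hom  = inclusion-isHom
    ; g∘f≈id = λ x∈ → x∈
    ; f∘g≈id = ∼-reflexive
    }

module RestrictedHom {a ℓa b ℓb} (A : SRL a ℓa) (B : SRL b ℓb)
                     (h : SRL.Carrier A → SRL.Carrier B) (isHom : IsSRLHom A B h) where
  private
    module A = SRLFacts A
    module B = SRLFacts B
  open IsSRLHom isHom

  h-cut : ∀ x → h (x A.∧ A.e) B.≈ (h x B.∧ B.e)
  h-cut x = B.trans (hom-∧ x A.e) (B.∧-cong B.refl hom-e)

  restriction-isHom : IsBrHom (NegCone A) (NegCone B) h
  restriction-isHom = record
    { maps-into = λ {x} x≤e → B.trans (B.sym (h-cut x)) (cong x≤e)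
    ; cong      = λ _ _ → cong
    ; hom-∧     = λ _ _ → hom-∧ _ _
    ; hom-∨     = λ _ _ → hom-∨ _ _
    ; hom-⇒     = λ {x} {y} _ _ → B.trans (h-cut (x A.⇒ y)) (B.∧-cong (hom-⇒ x y) B.refl)
    ; hom-e     = hom-e
    }

  -- a preimage x of y ≤ e can be cut down to the preimage x ∧ e in A⁻
  restriction-onto : Surjective B._≈_ h → SurjectiveOnto (NegCone A) (NegCone B) h
  restriction-onto onto y y≤e with onto y
  ... | x , hx≈y =
    x A.∧ A.e , A.x∧y≤y _ _ , B.trans (h-cut x) (B.trans (B.∧-cong hx≈y B.refl) y≤e)

  part-i : Part-i A B h
  part-i = restriction-isHom , restriction-onto

lemma5p2-SRL : ∀ {a ℓa b ℓb ℓf} (A : SRL a ℓa) (B : SRL b ℓb) (F : Pred (SRL.Carrier A) ℓf)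
               → IsDeductiveFilter A F
               → (∀ h → IsSRLHom A B h → Part-i A B h) × Part-ii A F
lemma5p2-SRL A B F isFilter = RestrictedHom.part-i A B , NegativeConeQuotient.part-ii A F isFilter

lemma5p2 : ∀ {a ℓa b ℓb ℓf}
           → (∀ (A : SRL a ℓa) (B : SRL b ℓb) (F : Pred (SRL.Carrier A) ℓf)
                → IsDeductiveFilter A F
                → (∀ h → IsSRLHom A B h → Part-i A B h) × Part-ii A F)
           × (∀ (A : SIRL a ℓa) (B : SIRL b ℓb) (F : Pred (SRL.Carrier (SIRL.srl A)) ℓf)
                → IsDeductiveFilter (SIRL.srl A) F
                → (∀ h → IsSIRLHom A B h → Part-i (SIRL.srl A) (SIRL.srl B) h) × Part-ii (SIRL.srl A) F)
lemma5p2 = lemma5p2-SRL , λ A B F isFilter →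
  let (hom-part , quotient-part) = lemma5p2-SRL (SIRL.srl A) (SIRL.srl B) F isFilter
  in (λ h isHom → hom-part h (IsSIRLHom.isSRLHom isHom)) , quotient-part
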